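{- Let $P$ be a path connected finite space and let $\mathrm{Max}(P)$ be its set of maximal points. Then $\mathrm{CC}_m(P)\le(\#\mathrm{Max}(P))^2$ for all sufficiently large $m\ge0$.
   Context: A finite space is a finite $T_0$ topological space, identified with a finite poset (open sets are down-sets; continuous maps are order-preserving maps). $J_m$ is the finite fence on $\{0,\dots,m\}$ with order $0<1>2<\cdots m$; $P^{J_m}$ is the finite space of continuous maps $J_m\to P$ with the pointwise order; $q_m(\gamma)=(\gamma(0),\gamma(m))$. $\mathrm{CC}_m(P)$ is the smallest $n\ge0$ such that some open cover $\{Q_i\}_{i=1}^n$ of $P\times P$ admits continuous sections $Q_i\to P^{J_m}$ of $q_m$ ($\infty$ if none). -}

module Defs where

open import Level using (0ℓ)
open import Data.Nat using (ℕ; zero; suc; _≤_; _%_)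
open import Data.Fin using (Fin; toℕ; fromℕ) renaming (zero to fzero)
open import Data.Fin.Properties using (all?) renaming (_≟_ to _≟F_)
open import Data.List using (List; length; filter; allFin)
open import Data.Bool using (Bool; true)
open import Data.Product using (Σ; ∃; ∃-syntax; _×_; _,_; proj₁; proj₂)
open import Data.Sum using (_⊎_)
open import Relation.Nullary using (Dec; _→-dec_)
open import Relation.Binary.Core using (Rel)
open import Relation.Binary.Definitions using (Decidable)
open import Relation.Binary.Structures using (IsPartialOrder)
open import Relation.Binary.PropositionalEquality using (_≡_)

-- Finite spaces = finite posets (carrier Fin size; x ≼ y means
-- x is in the closure of y, i.e. open sets are down-sets).

record FiniteSpace : Set₁ where
  field
    size    : ℕ
    _≼_     : Rel (Fin size) 0ℓ
    isPO    : IsPartialOrder _≡_ _≼_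
    ≼-dec   : Decidable _≼_

  Pt : Set
  Pt = Fin size

open FiniteSpace public

-- continuous = order preserving
Monotone : {A B : Set} → (A → A → Set) → (B → B → Set) → (A → B) → Set
Monotone {A} _≤A_ _≤B_ f = ∀ {x y : A} → x ≤A y → f x ≤B f y

-- The fence J_m on {0,…,m}: 0 < 1 > 2 < 3 > … (odd points are maximal)

Odd : ℕ → Set
Odd k = k % 2 ≡ 1

_≤J_ : {m : ℕ} → Fin (suc m) → Fin (suc m) → Set
i ≤J j = i ≡ j ⊎ (Odd (toℕ j) × (suc (toℕ i) ≡ toℕ j ⊎ suc (toℕ j) ≡ toℕ i))

PathSp : (P : FiniteSpace) → ℕ → Set
PathSp P m = Σ (Fin (suc m) → Pt P) (Monotone (_≤J_ {m}) (_≼_ P))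

_≤Path_ : {P : FiniteSpace} {m : ℕ} → PathSp P m → PathSp P m → Set
_≤Path_ {P} γ δ = ∀ i → _≼_ P (proj₁ γ i) (proj₁ δ i)

q : (P : FiniteSpace) (m : ℕ) → PathSp P m → Pt P × Pt P
q P m γ = proj₁ γ fzero , proj₁ γ (fromℕ m)

_≤×_ : {P : FiniteSpace} → Pt P × Pt P → Pt P × Pt P → Set
_≤×_ {P} (a , b) (c , d) = _≼_ P a c × _≼_ P b d

SubsetPP : FiniteSpace → Set
SubsetPP P = Pt P × Pt P → Bool

IsOpen : (P : FiniteSpace) → SubsetPP P → Set
IsOpen P Q = ∀ {x y} → Q y ≡ true → _≤×_ {P} x y → Q x ≡ true

⟨_⟩ : {P : FiniteSpace} → SubsetPP P → Set
⟨_⟩ {P} Q = Σ (Pt P × Pt P) (λ x → Q x ≡ true)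

Section : (P : FiniteSpace) (m : ℕ) → SubsetPP P → Set
Section P m Q =
  Σ (⟨_⟩ {P} Q → PathSp P m) λ s →
    Monotone (λ x y → _≤×_ {P} (proj₁ x) (proj₁ y)) (_≤Path_ {P} {m}) s
    × (∀ x → q P m (s x) ≡ proj₁ x)

GoodCover : (P : FiniteSpace) (m n : ℕ) → Set
GoodCover P m n =
  Σ (Fin n → SubsetPP P) λ Q →
    (∀ i → IsOpen P (Q i))
    × (∀ x → ∃[ i ] (Q i x ≡ true))
    × (∀ i → Section P m (Q i))

-- CC_m(P) ≤ k  (CC_m(P) is the least n with a GoodCover, or ∞)
CC≤ : (P : FiniteSpace) (m k : ℕ) → Set
CC≤ P m k = ∃[ n ] (n ≤ k × GoodCover P m n)

PathConnected : FiniteSpace → Set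
PathConnected P =
  ∀ (x y : Pt P) → ∃[ m ] Σ (PathSp P m) λ γ → q P m γ ≡ (x , y)

IsMaximal : (P : FiniteSpace) → Pt P → Set
IsMaximal P x = ∀ y → _≼_ P x y → y ≡ x

isMaximal? : (P : FiniteSpace) → (x : Pt P) → Dec (IsMaximal P x)
isMaximal? P x = all? (λ y → ≼-dec P x y →-dec (y ≟F x))

#Max : FiniteSpace → ℕ
#Max P = length (filter (isMaximal? P) (allFin (size P)))

-- For maximal points a and b the box ↓a × ↓b is open, and the #Max² such boxes cover
-- P × P because every point lies below a maximal one.  Over ↓a × ↓b, a fixed path γ from
-- a to b gives the continuous section (x , y) ↦ (x ≤ a ⇝γ⇝ b ≥ y).  Padding all paths
-- to one common odd length makes a single m work for every box, and then every larger m.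

module Submission where

open import Defs
open import Data.Nat using (ℕ; _≤_; _*_)
open import Data.Product using (∃-syntax)

open import Data.Nat using (zero; suc; _<_; _+_; _∸_; _⊔_; _≤?_; z≤n; s≤s)
open import Data.Nat.Properties
  using (≤-refl; <-irrefl; ≤-trans; ≤-antisym; ≤-pred; ≰⇒>; m≤n⇒m≤1+n; m≤m⊔n; m≤n⇒m≤o⊔n)
open import Data.Fin using (Fin; toℕ; fromℕ; combine; remQuot)
  renaming (zero to fzero; suc to fsuc)
open import Data.Fin.Properties using (toℕ-fromℕ; remQuot-combine; ¬∀⟶∃¬)
  renaming (_≟_ to _≟F_)
open import Data.Fin.Induction using (po-noetherian)
open import Data.List using (lookup; filter; allFin)
open import Data.List.Relation.Unary.Any using (index)
open import Data.List.Relation.Unary.Any.Properties using (lookup-index)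
open import Data.List.Membership.Propositional.Properties
  using (∈-allFin; ∈-lookup; ∈-filter⁺; ∈-filter⁻)
open import Data.Bool using (true)
open import Data.Bool.Properties using (T-≡)
open import Data.Product using (Σ; _×_; _,_; proj₁; proj₂)
import Data.Product as Product
open import Data.Sum using (_⊎_; inj₁; inj₂)
import Data.Sum as Sum
open import Function using (_∘_; flip; const)
open import Function.Bundles using (Equivalence)
open import Induction.WellFounded using (Acc; acc)
open import Relation.Nullary using (yes; no; does; ¬_; contradiction; _×-dec_; _→-dec_)
open import Relation.Nullary.Decidable using (toWitness; isYes≗does; dec-true)
open import Relation.Binary.Structures using (IsPartialOrder)
import Relation.Binary.Construct.NonStrictToStrict as ToStrict
open import Relation.Binary.PropositionalEquality
  using (_≡_; refl; sym; trans; cong; cong₂; subst)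

Odd⇒¬Odd-suc : ∀ n → Odd n → ¬ Odd (suc n)
Odd⇒¬Odd-suc (suc zero)    _ ()
Odd⇒¬Odd-suc (suc (suc n)) = Odd⇒¬Odd-suc n

odd-above : ∀ n → ∃[ k ] (Odd k × n ≤ k)
odd-above zero          = 1 , refl , z≤n
odd-above (suc zero)    = 1 , refl , ≤-refl
odd-above (suc (suc n)) = Product.map (suc ∘ suc) (Product.map₂ (s≤s ∘ s≤s)) (odd-above n)

bounded : ∀ {n} (f : Fin n → ℕ) → ∃[ B ] (∀ i → f i ≤ B)
bounded {zero}  f = 0 , λ ()
bounded {suc n} f with bounded (f ∘ fsuc)
... | B , f≤B = f fzero ⊔ B , λ
  { fzero    → m≤m⊔n _ _
  ; (fsuc i) → m≤n⇒m≤o⊔n (f fzero) (f≤B i)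
  }

bounded₂ : ∀ {n} (f : Fin n → Fin n → ℕ) → ∃[ B ] (∀ i j → f i j ≤ B)
bounded₂ f with bounded (proj₁ ∘ bounded ∘ f)
... | B , row≤B = B , λ i j → ≤-trans (proj₂ (bounded (f i)) j) (row≤B i)

-- The infinite fence 0 < 1 > 2 < 3 > ⋯, of which every J_m is a subspace.
_≤J∞_ : ℕ → ℕ → Set
i ≤J∞ j = i ≡ j ⊎ (Odd j × (suc i ≡ j ⊎ suc j ≡ i))

toℕ-mono : ∀ {m} → Monotone (_≤J_ {m}) _≤J∞_ toℕ
toℕ-mono = Sum.map₁ (cong toℕ)

∸2-mono : Monotone _≤J∞_ _≤J∞_ (_∸ 2)
∸2-mono (inj₁ refl) = inj₁ refl
∸2-mono {zero}        (inj₂ (_   , inj₁ refl)) = inj₁ refl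
∸2-mono {suc zero}    (inj₂ (()  , inj₁ refl))
∸2-mono {suc (suc i)} (inj₂ (odd , inj₁ refl)) = inj₂ (odd , inj₁ refl)
∸2-mono {y = suc zero}    (inj₂ (_   , inj₂ refl)) = inj₁ refl
∸2-mono {y = suc (suc j)} (inj₂ (odd , inj₂ refl)) = inj₂ (odd , inj₂ refl)

-- A retraction of the infinite fence onto J_L.
clamp : (L : ℕ) → ℕ → Fin (suc L)
clamp L       zero    = fzero
clamp zero    (suc t) = fzero
clamp (suc L) (suc t) = fsuc (clamp L t)

clamp-≥ : ∀ {L t} → L ≤ t → clamp L t ≡ fromℕ L
clamp-≥ {zero}  {zero}  _          = refl
clamp-≥ {zero}  {suc t} _          = refl
clamp-≥ {suc L} {suc t} (s≤s L≤t) = cong fsuc (clamp-≥ L≤t)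

clamp-step : ∀ L t →
  (toℕ (clamp L t) ≡ t × toℕ (clamp L (suc t)) ≡ suc t) ⊎ clamp L t ≡ clamp L (suc t)
clamp-step zero    zero    = inj₂ refl
clamp-step zero    (suc t) = inj₂ refl
clamp-step (suc L) zero    = inj₁ (refl , refl)
clamp-step (suc L) (suc t) =
  Sum.map (Product.map (cong suc) (cong suc)) (cong fsuc) (clamp-step L t)

clamp-mono : ∀ L → Monotone _≤J∞_ (_≤J_ {L}) (clamp L)
clamp-mono L (inj₁ refl) = inj₁ refl
clamp-mono L {i} (inj₂ (odd , inj₁ refl)) with clamp-step L i
... | inj₁ (i≡ , j≡) = inj₂ (subst Odd (sym j≡) odd , inj₁ (trans (cong suc i≡) (sym j≡)))
... | inj₂ i≡j       = inj₁ i≡j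
clamp-mono L {y = j} (inj₂ (odd , inj₂ refl)) with clamp-step L j
... | inj₁ (j≡ , i≡) = inj₂ (subst Odd (sym j≡) odd , inj₂ (trans (cong suc j≡) (sym i≡)))
... | inj₂ j≡i       = inj₁ (sym j≡i)

m≤n∧1+m≰n⇒m≡n : ∀ {m n} → m ≤ n → ¬ suc m ≤ n → m ≡ n
m≤n∧1+m≰n⇒m≡n m≤n 1+m≰n = ≤-antisym m≤n (≤-pred (≰⇒> 1+m≰n))

splice : {A : Set} → ℕ → (ℕ → A) → (ℕ → A) → ℕ → A
splice n f g t with t ≤? n
... | yes _ = f t
... | no  _ = g t

module _ {A : Set} (n : ℕ) (f g : ℕ → A) where

  splice-≤ : ∀ {t} → t ≤ n → splice n f g t ≡ f t
  splice-≤ {t} t≤n with t ≤? n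
  ... | yes _   = refl
  ... | no  t≰n = contradiction t≤n t≰n

  splice-> : ∀ {t} → n < t → splice n f g t ≡ g t
  splice-> {t} n<t with t ≤? n
  ... | yes t≤n = contradiction (≤-trans n<t t≤n) (<-irrefl refl)
  ... | no  _   = refl

  module _ (_⊑_ : A → A → Set) where

    splice-pointwise : ∀ {f′ g′} → (∀ t → f t ⊑ f′ t) → (∀ t → g t ⊑ g′ t) →
      ∀ t → splice n f g t ⊑ splice n f′ g′ t
    splice-pointwise f⊑f′ g⊑g′ t with t ≤? n
    ... | yes _ = f⊑f′ t
    ... | no  _ = g⊑g′ t

    splice-mono : Monotone _≤J∞_ _⊑_ f → Monotone _≤J∞_ _⊑_ g →
      (Odd (suc n) → f n ⊑ g (suc n)) → (Odd n → g (suc n) ⊑ f n) →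
      Monotone _≤J∞_ _⊑_ (splice n f g)
    splice-mono f-mono g-mono up down {i} {j} i≤j with i ≤? n | j ≤? n | i≤j
    ... | yes _   | yes _   | _                    = f-mono i≤j
    ... | no  _   | no  _   | _                    = g-mono i≤j
    ... | yes i≤n | no  j≰n | inj₁ refl            = contradiction i≤n j≰n
    ... | yes i≤n | no  j≰n | inj₂ (odd , inj₁ refl) =
      subst (λ k → f k ⊑ g (suc k)) (sym i≡n) (up (subst (Odd ∘ suc) i≡n odd))
      where i≡n = m≤n∧1+m≰n⇒m≡n i≤n j≰n
    ... | yes i≤n | no  j≰n | inj₂ (_ , inj₂ refl) =
      contradiction (≤-trans (m≤n⇒m≤1+n ≤-refl) i≤n) j≰n
    ... | no  i≰n | yes j≤n | inj₁ refl            = contradiction j≤n i≰n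
    ... | no  i≰n | yes j≤n | inj₂ (_ , inj₁ refl) =
      contradiction (≤-trans (m≤n⇒m≤1+n ≤-refl) j≤n) i≰n
    ... | no  i≰n | yes j≤n | inj₂ (odd , inj₂ refl) =
      subst (λ k → g (suc k) ⊑ f k) (sym j≡n) (down (subst Odd j≡n odd))
      where j≡n = m≤n∧1+m≰n⇒m≡n j≤n i≰n

module _ (P : FiniteSpace) where

  infix 4 _⊑_
  _⊑_ : Pt P → Pt P → Set
  _⊑_ = _≼_ P

  open IsPartialOrder (isPO P) using () renaming (refl to ⊑-refl; trans to ⊑-trans)

  restrict : ∀ m (g : ℕ → Pt P) → Monotone _≤J∞_ _⊑_ g → PathSp P m
  restrict m g g-mono = g ∘ toℕ , g-mono ∘ toℕ-mono

  extend : ∀ {L} → PathSp P L → ℕ → Pt P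
  extend {L} γ = proj₁ γ ∘ clamp L

  extend-mono : ∀ {L} (γ : PathSp P L) → Monotone _≤J∞_ _⊑_ (extend γ)
  extend-mono {L} γ = proj₂ γ ∘ clamp-mono L

  extend-≥ : ∀ {L t} (γ : PathSp P L) → L ≤ t → extend γ t ≡ proj₁ γ (fromℕ L)
  extend-≥ γ L≤t = cong (proj₁ γ) (clamp-≥ L≤t)

  lengthen : ∀ {ℓ L} → ℓ ≤ L → (γ : PathSp P ℓ) → Σ (PathSp P L) λ δ → q P L δ ≡ q P ℓ γ
  lengthen {L = L} ℓ≤L γ =
    restrict L (extend γ) (extend-mono γ) ,
    cong (proj₁ γ fzero ,_) (extend-≥ γ (subst (_ ≤_) (sym (toℕ-fromℕ L)) ℓ≤L))

  uniformly-path-connected : PathConnected P →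
    ∃[ L ] (Odd L × ∀ x y → Σ (PathSp P L) λ γ → q P L γ ≡ (x , y))
  uniformly-path-connected connected with bounded₂ (λ x y → proj₁ (connected x y))
  ... | B , length≤B with odd-above B
  ... | L , odd , B≤L = L , odd , λ x y →
    let (_ , γ , qγ) = connected x y
        (δ , qδ)     = lengthen (≤-trans (length≤B x y) B≤L) γ
    in δ , trans qδ qγ

  strictly-above : ∀ x → ¬ IsMaximal P x → ∃[ y ] (x ⊑ y × ¬ x ≡ y)
  strictly-above x ¬max
    with ¬∀⟶∃¬ (size P) _ (λ y → ≼-dec P x y →-dec (y ≟F x)) ¬max
  ... | y , ¬[x⊑y⇒y≡x] with ≼-dec P x y | y ≟F x
  ... | yes x⊑y | no  y≢x = y , x⊑y , y≢x ∘ sym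
  ... | yes _   | yes y≡x = contradiction (const y≡x) ¬[x⊑y⇒y≡x]
  ... | no  x⋢y | _       = contradiction (λ x⊑y → contradiction x⊑y x⋢y) ¬[x⊑y⇒y≡x]

  maximal-above : ∀ x → ∃[ a ] (IsMaximal P a × x ⊑ a)
  maximal-above x = go (po-noetherian (isPO P) x)
    where
    go : ∀ {x} → Acc (flip (ToStrict._<_ _≡_ _⊑_)) x → ∃[ a ] (IsMaximal P a × x ⊑ a)
    go {x} (acc above) with isMaximal? P x
    ... | yes max = x , max , ⊑-refl
    ... | no ¬max with strictly-above x ¬max
    ...   | y , x<y = Product.map₂ (Product.map₂ (⊑-trans (proj₁ x<y))) (go (above x<y))

  maximal : Fin (#Max P) → Pt P
  maximal = lookup (filter (isMaximal? P) (allFin (size P)))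

  maximal-isMaximal : ∀ i → IsMaximal P (maximal i)
  maximal-isMaximal i = proj₂ (∈-filter⁻ (isMaximal? P) {xs = allFin (size P)} (∈-lookup i))

  maximal-surjective : ∀ {a} → IsMaximal P a → ∃[ i ] (maximal i ≡ a)
  maximal-surjective max = index a∈ , sym (lookup-index a∈)
    where a∈ = ∈-filter⁺ (isMaximal? P) (∈-allFin _) max

  ↓[_,_] : Pt P → Pt P → SubsetPP P
  ↓[ a , b ] (x , y) = does (≼-dec P x a ×-dec ≼-dec P y b)

  ∈↓⁺ : ∀ {a b x y} → x ⊑ a × y ⊑ b → ↓[ a , b ] (x , y) ≡ true
  ∈↓⁺ {a} {b} {x} {y} = dec-true (≼-dec P x a ×-dec ≼-dec P y b)

  ∈↓⁻ : ∀ {a b x y} → ↓[ a , b ] (x , y) ≡ true → x ⊑ a × y ⊑ b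
  ∈↓⁻ {a} {b} {x} {y} ∈↓ =
    toWitness (Equivalence.from T-≡ (trans (isYes≗does (≼-dec P x a ×-dec ≼-dec P y b)) ∈↓))

  ↓-open : ∀ a b → IsOpen P ↓[ a , b ]
  ↓-open a b ∈↓ (x⊑x′ , y⊑y′) =
    ∈↓⁺ (⊑-trans x⊑x′ (proj₁ (∈↓⁻ ∈↓)) , ⊑-trans y⊑y′ (proj₂ (∈↓⁻ ∈↓)))

  maximal-boxes-cover : ∀ {m} →
    (∀ a b → IsMaximal P a → IsMaximal P b → Section P m ↓[ a , b ]) →
    GoodCover P m (#Max P * #Max P)
  maximal-boxes-cover section =
    box ∘ remQuot (#Max P) ,
    (λ _ → ↓-open _ _) ,
    covered ,
    (λ c → let (i , j) = remQuot (#Max P) c in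
           section _ _ (maximal-isMaximal i) (maximal-isMaximal j))
    where
    box : Fin (#Max P) × Fin (#Max P) → SubsetPP P
    box (i , j) = ↓[ maximal i , maximal j ]

    covered : ∀ z → ∃[ c ] (box (remQuot (#Max P) c) z ≡ true)
    covered (x , y) =
      let (a , a-max , x⊑a) = maximal-above x
          (b , b-max , y⊑b) = maximal-above y
          (i , i↦a) = maximal-surjective a-max
          (j , j↦b) = maximal-surjective b-max
      in combine i j ,
         subst (λ ij → box ij (x , y) ≡ true) (sym (remQuot-combine i j))
           (∈↓⁺ (subst (x ⊑_) (sym i↦a) x⊑a , subst (y ⊑_) (sym j↦b) y⊑b))

  -- γ is shifted by two positions, which keeps its parity, and is left right after the
  -- odd position 2 + n, where it sits at b ≥ y.
  box-section : ∀ {n a b} → Odd n → (Σ (PathSp P n) λ γ → q P n γ ≡ (a , b)) →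
    ∀ m → 3 + n ≤ m → Section P m ↓[ a , b ]
  box-section {n} {a} {b} odd (γ , qγ) m 3+n≤m =
    section , (λ {z} {w} → section-mono {z} {w}) , section-ends
    where
    γ⁺ : ℕ → Pt P
    γ⁺ = extend γ ∘ (_∸ 2)

    γ⁺-then : Pt P → ℕ → Pt P
    γ⁺-then y = splice (2 + n) γ⁺ (const y)

    walk : Pt P → Pt P → ℕ → Pt P
    walk x y = splice 0 (const x) (γ⁺-then y)

    γ⁺-starts-at-a : ∀ {y} → γ⁺-then y 1 ≡ a
    γ⁺-starts-at-a {y} = trans (splice-≤ (2 + n) γ⁺ (const y) (s≤s z≤n)) (cong proj₁ qγ)

    γ⁺-ends-at-b : γ⁺ (2 + n) ≡ b
    γ⁺-ends-at-b = trans (extend-≥ γ ≤-refl) (cong proj₂ qγ)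

    walk-mono : ∀ {x y} → x ⊑ a → y ⊑ b → Monotone _≤J∞_ _⊑_ (walk x y)
    walk-mono {x} {y} x⊑a y⊑b =
      splice-mono 0 (const x) (γ⁺-then y) _⊑_ (const ⊑-refl)
        (splice-mono (2 + n) γ⁺ (const y) _⊑_ (extend-mono γ ∘ ∸2-mono) (const ⊑-refl)
          (λ odd′ → contradiction odd′ (Odd⇒¬Odd-suc n odd))
          (λ _ → subst (y ⊑_) (sym γ⁺-ends-at-b) y⊑b))
        (λ _ → subst (x ⊑_) (sym (γ⁺-starts-at-a {y})) x⊑a)
        (λ ())

    walk-pointwise : ∀ {x x′ y y′} → x ⊑ x′ → y ⊑ y′ → ∀ t → walk x y t ⊑ walk x′ y′ t
    walk-pointwise {x} {y = y} x⊑x′ y⊑y′ =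
      splice-pointwise 0 (const x) (γ⁺-then y) _⊑_ (const x⊑x′)
        (splice-pointwise (2 + n) γ⁺ (const y) _⊑_ (λ _ → ⊑-refl) (const y⊑y′))

    walk-end : ∀ {x y t} → 3 + n ≤ t → walk x y t ≡ y
    walk-end {x} {y} 3+n≤t =
      trans (splice-> 0 (const x) (γ⁺-then y) (≤-trans (s≤s z≤n) 3+n≤t))
            (splice-> (2 + n) γ⁺ (const y) 3+n≤t)

    section : ⟨_⟩ {P} ↓[ a , b ] → PathSp P m
    section ((x , y) , ∈↓) =
      restrict m (walk x y) (Product.uncurry walk-mono (∈↓⁻ {a} {b} {x} {y} ∈↓))

    section-mono : Monotone (λ z w → _≤×_ {P} (proj₁ z) (proj₁ w)) (_≤Path_ {P} {m}) section
    section-mono (x⊑x′ , y⊑y′) = walk-pointwise x⊑x′ y⊑y′ ∘ toℕ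

    section-ends : ∀ z → q P m (section z) ≡ proj₁ z
    section-ends ((x , y) , _) =
      cong₂ _,_ (splice-≤ 0 (const x) (γ⁺-then y) z≤n)
                (trans (cong (walk x y) (toℕ-fromℕ m)) (walk-end 3+n≤m))

corollary2p6 : (P : FiniteSpace) → PathConnected P →
    ∃[ M ] (∀ (m : ℕ) → M ≤ m → CC≤ P m (#Max P * #Max P))
corollary2p6 P connected with uniformly-path-connected P connected
... | n , odd , path = 3 + n , λ m 3+n≤m →
  #Max P * #Max P , ≤-refl ,
  maximal-boxes-cover P (λ a b _ _ → box-section P odd (path a b) m 3+n≤m)
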